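{- Let $\mathcal{L}$ be a finite language and $\ast_c$ a choice revision on $K$. Then $\ast_c$ satisfies, for all finite $A,B\subseteq\mathcal{L}$, (closure) $\mathrm{Cn}(K\ast_c A)=K\ast_c A$; (success) if $A\neq\emptyset$ then $A\cap(K\ast_c A)\neq\emptyset$; (vacuity) if $A=\emptyset$ then $K\ast_c A=K$; (confirmation) if $A\cap K\neq\emptyset$ then $K\ast_c A=K$; (reciprocity) if $(K\ast_c A)\cap B\neq\emptyset$ and $(K\ast_c B)\cap A\neq\emptyset$ then $K\ast_c A=K\ast_c B$; (consistency) if $A\not\equiv\{\bot\}$ then $\bot\notin K\ast_c A$, if and only if $\ast_c$ is the choice revision determined by some relational model $(\mathbb{X},\leqq)$ with respect to $K$ which moreover satisfies: $\mathrm{Cn}(\{\bot\})\in\mathbb{X}$; and for every $\varphi$ with $\bot\notin\mathrm{Cn}(\{\varphi\})$, the set $\{X\in\mathbb{X}\mid\varphi\in X\}$ is nonempty and its unique $\leqq$-minimal element $M_\varphi$ satisfies $M_\varphi<\mathrm{Cn}(\{\bot\})$ (where $<$ is the strict part of $\leqq$).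
   Context: $\mathcal{L}$ is a propositional language generated by a set of propositional variables with $\neg,\wedge,\vee,\rightarrow$; $\bot$ denotes a contradiction. $\mathrm{Cn}$ is a consequence operation on $\mathcal{L}$ that is supraclassical, compact and satisfies the deduction property. $\varphi\dashv\vdash\psi$ means each is in $\mathrm{Cn}$ of the other. For sets $A,B$, $A\equiv B$ iff every element of $A$ is $\dashv\vdash$-equivalent to some element of $B$ and vice versa. A belief set is $X\subseteq\mathcal{L}$ with $X=\mathrm{Cn}(X)$. $K$ is a fixed consistent belief set. A choice revision on $K$ is a function $\ast_c$ assigning to each finite $A\subseteq\mathcal{L}$ a set $K\ast_c A\subseteq\mathcal{L}$. Belief descriptors: an atomic descriptor is $\mathfrak{B}\varphi$; molecular descriptors are truth-functional combinations of atomic ones; a descriptor is a set of molecular descriptors. A belief set $X$ satisfies $\mathfrak{B}\varphi$ iff $\varphi\in X$, satisfaction extends truth-functionally, and $X$ satisfies a descriptor iff it satisfies all its elements. A relational model with respect to $K$ is a pair $(\mathbb{X},\leqq)$ where $\mathbb{X}$ is a set of belief sets with $K\in\mathbb{X}$, $\leqq$ is a binary relation on $\mathbb{X}$ with $K\leqq X$ for all $X\in\mathbb{X}$, and for every descriptor $\Phi$, if the set of elements of $\mathbb{X}$ satisfying $\Phi$ is nonempty then it has a unique $\leqq$-minimal element. For nonempty finite $A$, write $\mathbb{X}_A=\{X\in\mathbb{X}\mid X\cap A\neq\emptyset\}$ (the elements satisfying $\{\mathfrak{B}\varphi_0\vee\cdots\vee\mathfrak{B}\varphi_n\}$ for $A=\{\varphi_0,\dots,\varphi_n\}$).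 The choice revision determined by $(\mathbb{X},\leqq)$ is: $K\ast_c A$ is the unique $\leqq$-minimal element of $\mathbb{X}_A$ if $A\neq\emptyset$ and $\mathbb{X}_A\neq\emptyset$, and $K\ast_c A=K$ otherwise. -}

module Defs where

open import Level using (Level; 0ℓ) renaming (suc to lsuc)
open import Data.Nat using (ℕ; suc)
open import Data.Fin using (Fin; zero)
open import Data.Bool using (Bool; true; false; not; _∧_; _∨_)
open import Data.List using (List; []; _∷_; [_])
open import Data.List.Membership.Propositional using (_∈_)
open import Data.Product using (Σ; ∃; ∃-syntax; _×_; _,_)
open import Data.Sum using (_⊎_)
open import Relation.Nullary using (¬_)
open import Relation.Binary.PropositionalEquality using (_≡_; _≢_)

-- The propositional language over the finite set of variables Fin (suc m)
-- (at least one variable, so that a contradiction ⊥ is expressible).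

data Formula (m : ℕ) : Set where
  var  : Fin (suc m) → Formula m
  ¬'_  : Formula m → Formula m
  _∧'_ : Formula m → Formula m → Formula m
  _∨'_ : Formula m → Formula m → Formula m
  _⇒'_ : Formula m → Formula m → Formula m

⊥f : ∀ {m} → Formula m
⊥f = var zero ∧' (¬' var zero)

impB : Bool → Bool → Bool
impB a b = not a ∨ b

eval : ∀ {m} → (Fin (suc m) → Bool) → Formula m → Bool
eval v (var x)  = v x
eval v (¬' φ)   = not (eval v φ)
eval v (φ ∧' ψ) = eval v φ ∧ eval v ψ
eval v (φ ∨' ψ) = eval v φ ∨ eval v ψ
eval v (φ ⇒' ψ) = impB (eval v φ) (eval v ψ)

FSet : ℕ → Set₁
FSet m = Formula m → Set

_⊆_ : ∀ {m} → FSet m → FSet m → Set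
A ⊆ B = ∀ φ → A φ → B φ

_≐_ : ∀ {m} → FSet m → FSet m → Set
A ≐ B = (A ⊆ B) × (B ⊆ A)

｛_｝ : ∀ {m} → Formula m → FSet m
｛ φ ｝ = λ x → x ≡ φ

_∪_ : ∀ {m} → FSet m → FSet m → FSet m
(A ∪ B) φ = A φ ⊎ B φ

⟦_⟧ : ∀ {m} → List (Formula m) → FSet m
⟦ L ⟧ φ = φ ∈ L

_⊨_ : ∀ {m} → FSet m → Formula m → Set
A ⊨ φ = ∀ v → (∀ ψ → A ψ → eval v ψ ≡ true) → eval v φ ≡ true

record IsConsequence {m : ℕ} (Cn : FSet m → FSet m) : Set₁ where
  field
    inclusion      : ∀ A → A ⊆ Cn A
    monotony       : ∀ A B → A ⊆ B → Cn A ⊆ Cn B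
    iteration      : ∀ A → Cn (Cn A) ⊆ Cn A
    supraclassical : ∀ A φ → A ⊨ φ → Cn A φ
    compact        : ∀ A φ → Cn A φ →
                     ∃[ L ] ((⟦ L ⟧ ⊆ A) × Cn ⟦ L ⟧ φ)
    deduction      : ∀ A φ ψ → (Cn (A ∪ ｛ φ ｝) ψ → Cn A (φ ⇒' ψ))
                                × (Cn A (φ ⇒' ψ) → Cn (A ∪ ｛ φ ｝) ψ)

module _ {m : ℕ} (Cn : FSet m → FSet m) where

  Equiv : Formula m → Formula m → Set
  Equiv φ ψ = Cn ｛ ψ ｝ φ × Cn ｛ φ ｝ ψ

  SetEquiv : List (Formula m) → List (Formula m) → Set
  SetEquiv A B = (∀ φ → φ ∈ A → ∃[ ψ ] (ψ ∈ B × Equiv φ ψ))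
               × (∀ ψ → ψ ∈ B → ∃[ φ ] (φ ∈ A × Equiv φ ψ))

  BeliefSet : FSet m → Set
  BeliefSet X = X ≐ Cn X

  ConsistentBeliefSet : FSet m → Set
  ConsistentBeliefSet K = BeliefSet K × ¬ K ⊥f

-- Choice revisions: functions on finite sets of formulas. Finite sets are
-- represented by lists; the function must depend only on the set of
-- elements of the list.

record ChoiceRevision (m : ℕ) : Set₁ where
  field
    rev  : List (Formula m) → FSet m
    resp : ∀ A B → (∀ φ → (φ ∈ A → φ ∈ B) × (φ ∈ B → φ ∈ A)) → rev A ≐ rev B

open ChoiceRevision public

Meets : ∀ {m} → FSet m → List (Formula m) → Set
Meets X A = ∃[ φ ] (φ ∈ A × X φ)

module _ {m : ℕ} (Cn : FSet m → FSet m) (K : FSet m) (R : ChoiceRevision m) where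

  private
    _*_ : FSet m → List (Formula m) → FSet m
    _ * A = rev R A

  Closure : Set
  Closure = ∀ A → Cn (K * A) ≐ (K * A)

  Success : Set
  Success = ∀ A → A ≢ [] → Meets (K * A) A

  Vacuity : Set
  Vacuity = ∀ A → A ≡ [] → (K * A) ≐ K

  Confirmation : Set
  Confirmation = ∀ A → Meets K A → (K * A) ≐ K

  Reciprocity : Set
  Reciprocity = ∀ A B → Meets (K * A) B → Meets (K * B) A → (K * A) ≐ (K * B)

  Consistency : Set
  Consistency = ∀ A → ¬ SetEquiv Cn A [ ⊥f ] → ¬ (K * A) ⊥f

  Postulates : Set
  Postulates = Closure × Success × Vacuity × Confirmation × Reciprocity × Consistency

data Mol (m : ℕ) : Set where
  𝔅    : Formula m → Mol m
  neg  : Mol m → Mol m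
  and  : Mol m → Mol m → Mol m
  or   : Mol m → Mol m → Mol m
  imp  : Mol m → Mol m → Mol m

Descriptor : ℕ → Set₁
Descriptor m = Mol m → Set

SatMol : ∀ {m} → FSet m → Mol m → Set
SatMol X (𝔅 φ)     = X φ
SatMol X (neg μ)   = ¬ SatMol X μ
SatMol X (and μ ν) = SatMol X μ × SatMol X ν
SatMol X (or μ ν)  = SatMol X μ ⊎ SatMol X ν
SatMol X (imp μ ν) = SatMol X μ → SatMol X ν

Sat : ∀ {m} → FSet m → Descriptor m → Set
Sat X Φ = ∀ μ → Φ μ → SatMol X μ

module _ {m : ℕ} (_≦_ : FSet m → FSet m → Set) where

  _<_ : FSet m → FSet m → Set
  X < Y = (X ≦ Y) × ¬ (Y ≦ X)

  IsMinimal : (FSet m → Set) → FSet m → Set₁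
  IsMinimal S M = S M × (∀ Y → S Y → ¬ (Y < M))

  IsUniqueMinimal : (FSet m → Set) → FSet m → Set₁
  IsUniqueMinimal S M = IsMinimal S M × (∀ M' → IsMinimal S M' → M' ≐ M)

record RelModel {m : ℕ} (Cn : FSet m → FSet m) (K : FSet m) : Set₁ where
  field
    𝕏        : FSet m → Set
    _≦_      : FSet m → FSet m → Set
    𝕏-resp   : ∀ X Y → X ≐ Y → 𝕏 X → 𝕏 Y
    ≦-resp   : ∀ X X' Y Y' → X ≐ X' → Y ≐ Y' → X ≦ Y → X' ≦ Y'
    𝕏-belief : ∀ X → 𝕏 X → BeliefSet Cn X
    K∈𝕏      : 𝕏 K
    K-least  : ∀ X → 𝕏 X → K ≦ X
    descr    : ∀ (Φ : Descriptor m) →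
               ∃[ X ] (𝕏 X × Sat X Φ) →
               ∃[ M ] IsUniqueMinimal _≦_ (λ X → 𝕏 X × Sat X Φ) M

open RelModel public

module _ {m : ℕ} {Cn : FSet m → FSet m} {K : FSet m} (𝓜 : RelModel Cn K) where

  𝕏[_] : List (Formula m) → FSet m → Set
  𝕏[ A ] X = 𝕏 𝓜 X × Meets X A

  DeterminedBy : ChoiceRevision m → Set₁
  DeterminedBy R =
      (∀ A → A ≢ [] → ∃[ X ] 𝕏[ A ] X →
         IsUniqueMinimal (_≦_ 𝓜) 𝕏[ A ] (rev R A))
    × (∀ A → ((A ≡ []) ⊎ (¬ (∃[ X ] 𝕏[ A ] X))) → rev R A ≐ K)

  Extra : Set₁
  Extra = 𝕏 𝓜 (Cn ｛ ⊥f ｝)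
        × (∀ φ → ¬ Cn ｛ φ ｝ ⊥f →
             ∃[ M ] (IsUniqueMinimal (_≦_ 𝓜) (λ X → 𝕏 𝓜 X × X φ) M
                     × _<_ (_≦_ 𝓜) M (Cn ｛ ⊥f ｝)))

module Submission where

-- Soundness: K ∗ A is the ≦-minimum of 𝕏_A, which is inhabited by Cn{⊥} whenever A ≠ ∅.
-- Closure, success and vacuity are then immediate, confirmation holds because K is least,
-- reciprocity because the minimum of 𝕏_{A∪B} is also the minimum of whichever of 𝕏_A, 𝕏_B
-- it belongs to, and consistency because a consistent φ ∈ A has a minimum strictly below
-- Cn{⊥}.
--
-- Completeness: over finitely many variables every belief set is Cn{r} for one of finitely
-- many normal forms r.  Take 𝕏 to be the range of ∗ and let X ≦ Y iff K ∗ {r_X, r_Y} = X.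
-- Reciprocity makes K ∗ {a, b} depend only on Cn{a} and Cn{b}, which makes ≦ antisymmetric,
-- and it puts K ∗ A ≦-below every outcome that meets A.  So K ∗ A is the minimum of 𝕏_A,
-- and the minimum for a descriptor Φ is K ∗ A_Φ, where A_Φ collects the normal forms of the
-- outcomes satisfying Φ.

open import Defs
open import Level using (0ℓ; lift; lower) renaming (suc to lsuc)
open import Axiom.ExcludedMiddle using (ExcludedMiddle)
open import Function using (_∘_; const; id)
open import Data.Nat using (ℕ; suc)
open import Data.Fin using (Fin; zero; _≟_)
open import Data.Bool using (Bool; true; false; not; _∧_; _∨_; if_then_else_)
open import Data.Bool.Properties using (∨-identityʳ; ∧-conicalˡ; ∧-conicalʳ)
open import Data.Vec.Functional using (updateAt)
open import Data.Vec.Functional.Properties using (updateAt-updates; updateAt-minimal)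
open import Data.List using (List; []; _∷_; [_]; _++_; filter; allFin; cartesianProductWith)
open import Data.List.Membership.Propositional using (_∈_)
open import Data.List.Membership.Propositional.Properties
  using (∈-++⁻; ∈-++⁺ˡ; ∈-++⁺ʳ; ∈-cartesianProductWith⁺; ∈-filter⁺; ∈-filter⁻; ∈-allFin)
open import Data.List.Relation.Unary.Any using (here; there; tail)
open import Data.Product using (Σ; ∃-syntax; _×_; _,_; proj₁; proj₂)
open import Data.Sum using (_⊎_; inj₁; inj₂)
open import Data.Empty using (⊥-elim)
open import Relation.Nullary using (¬_; Dec; yes; no)
open import Relation.Nullary.Decidable using (map′; decidable-stable)
open import Relation.Unary using (Decidable)
open import Relation.Binary.PropositionalEquality using (_≡_; _≢_; refl; sym; trans; cong; cong₂)

module _ {m : ℕ} where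

  ≐-refl : {A : FSet m} → A ≐ A
  ≐-refl = (λ _ a → a) , (λ _ a → a)

  ≐-sym : {A B : FSet m} → A ≐ B → B ≐ A
  ≐-sym (A⊆B , B⊆A) = B⊆A , A⊆B

  ≐-trans : {A B C : FSet m} → A ≐ B → B ≐ C → A ≐ C
  ≐-trans (A⊆B , B⊆A) (B⊆C , C⊆B) = (λ φ a → B⊆C φ (A⊆B φ a)) , (λ φ c → B⊆A φ (C⊆B φ c))

  SatMol-resp : {X Y : FSet m} → X ≐ Y → ∀ μ → SatMol X μ → SatMol Y μ
  SatMol-resp X≐Y (𝔅 φ)     s         = proj₁ X≐Y φ s
  SatMol-resp X≐Y (neg μ)   s         = s ∘ SatMol-resp (≐-sym X≐Y) μ
  SatMol-resp X≐Y (and μ ν) (sμ , sν) = SatMol-resp X≐Y μ sμ , SatMol-resp X≐Y ν sν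
  SatMol-resp X≐Y (or μ ν)  (inj₁ sμ) = inj₁ (SatMol-resp X≐Y μ sμ)
  SatMol-resp X≐Y (or μ ν)  (inj₂ sν) = inj₂ (SatMol-resp X≐Y ν sν)
  SatMol-resp X≐Y (imp μ ν) s         = SatMol-resp X≐Y ν ∘ s ∘ SatMol-resp (≐-sym X≐Y) μ

  Sat-resp : {X Y : FSet m} {Φ : Descriptor m} → X ≐ Y → Sat X Φ → Sat Y Φ
  Sat-resp X≐Y s μ μ∈Φ = SatMol-resp X≐Y μ (s μ μ∈Φ)

  Meets-resp : {X Y : FSet m} {A : List (Formula m)} → X ≐ Y → Meets X A → Meets Y A
  Meets-resp X≐Y (φ , φ∈A , Xφ) = φ , φ∈A , proj₁ X≐Y φ Xφ

  Meets-++⁻ : {X : FSet m} (A : List (Formula m)) {B : List (Formula m)} →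
              Meets X (A ++ B) → Meets X A ⊎ Meets X B
  Meets-++⁻ A (φ , φ∈A++B , Xφ) with ∈-++⁻ A φ∈A++B
  ... | inj₁ φ∈A = inj₁ (φ , φ∈A , Xφ)
  ... | inj₂ φ∈B = inj₂ (φ , φ∈B , Xφ)

  ∈⇒≢[] : {φ : Formula m} {A : List (Formula m)} → φ ∈ A → A ≢ []
  ∈⇒≢[] (here _)  ()
  ∈⇒≢[] (there _) ()

  Meets⇒≢[] : {X : FSet m} {A : List (Formula m)} → Meets X A → A ≢ []
  Meets⇒≢[] (_ , φ∈A , _) = ∈⇒≢[] φ∈A

  minimal-restrict : {_≦_ : FSet m → FSet m → Set} {S S′ : FSet m → Set} {M : FSet m} →
                     (∀ X → S′ X → S X) → IsMinimal _≦_ S M → S′ M → IsMinimal _≦_ S′ M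
  minimal-restrict S′⊆S (_ , minimal) S′M = S′M , (λ Y S′Y → minimal Y (S′⊆S Y S′Y))

Valuation : ℕ → Set
Valuation m = Fin (suc m) → Bool

module _ {m : ℕ} where

  eval-⊥f : (v : Valuation m) → eval v ⊥f ≡ false
  eval-⊥f v with v zero
  ... | true  = refl
  ... | false = refl

  ⊥f-⊨ : {X : FSet m} → X ⊥f → ∀ φ → X ⊨ φ
  ⊥f-⊨ X⊥ φ v true-on-X with trans (sym (true-on-X ⊥f X⊥)) (eval-⊥f v)
  ... | ()

  ⊤f : Formula m
  ⊤f = ¬' ⊥f

  eval-⊤f : (v : Valuation m) → eval v ⊤f ≡ true
  eval-⊤f v = cong not (eval-⊥f v)

  eval-cong : {v w : Valuation m} → (∀ x → v x ≡ w x) → ∀ φ → eval v φ ≡ eval w φ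
  eval-cong v≗w (var x)  = v≗w x
  eval-cong v≗w (¬' φ)   = cong not (eval-cong v≗w φ)
  eval-cong v≗w (φ ∧' ψ) = cong₂ _∧_ (eval-cong v≗w φ) (eval-cong v≗w ψ)
  eval-cong v≗w (φ ∨' ψ) = cong₂ _∨_ (eval-cong v≗w φ) (eval-cong v≗w ψ)
  eval-cong v≗w (φ ⇒' ψ) = cong₂ impB (eval-cong v≗w φ) (eval-cong v≗w ψ)

  branch : Fin (suc m) → Formula m → Formula m → Formula m
  branch x φ ψ = (var x ∧' φ) ∨' ((¬' var x) ∧' ψ)

  shannon : List (Fin (suc m)) → (Valuation m → Bool) → Formula m
  shannon []       g = if g (const false) then ⊤f else ⊥f
  shannon (x ∷ xs) g = branch x (shannon xs (λ u → g (updateAt u x (const true))))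
                                (shannon xs (λ u → g (updateAt u x (const false))))

  shannonForms : List (Fin (suc m)) → List (Formula m)
  shannonForms []       = ⊤f ∷ ⊥f ∷ []
  shannonForms (x ∷ xs) = cartesianProductWith (branch x) (shannonForms xs) (shannonForms xs)

  shannon∈shannonForms : ∀ xs g → shannon xs g ∈ shannonForms xs
  shannon∈shannonForms [] g with g (const false)
  ... | true  = here refl
  ... | false = there (here refl)
  shannon∈shannonForms (x ∷ xs) g =
    ∈-cartesianProductWith⁺ (branch x) (shannon∈shannonForms xs _) (shannon∈shannonForms xs _)

  restrictTo : List (Fin (suc m)) → Valuation m → Valuation m
  restrictTo []       v = const false
  restrictTo (x ∷ xs) v = updateAt (restrictTo xs v) x (const (v x))

  restrictTo-agrees : ∀ xs v y → y ∈ xs → restrictTo xs v y ≡ v y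
  restrictTo-agrees (x ∷ xs) v y y∈ with y ≟ x
  ... | yes refl = updateAt-updates y (restrictTo xs v)
  ... | no y≢x   = trans (updateAt-minimal y x (restrictTo xs v) y≢x) (restrictTo-agrees xs v y (tail y≢x y∈))

  eval-shannon : ∀ xs g v → eval v (shannon xs g) ≡ g (restrictTo xs v)
  eval-shannon [] g v with g (const false)
  ... | true  = eval-⊤f v
  ... | false = eval-⊥f v
  eval-shannon (x ∷ xs) g v with v x
  ... | true  = trans (∨-identityʳ _) (eval-shannon xs _ v)
  ... | false = eval-shannon xs _ v

  normalForms : List (Formula m)
  normalForms = shannonForms (allFin (suc m))

  normalForm : Formula m → Formula m
  normalForm φ = shannon (allFin (suc m)) (λ v → eval v φ)

  normalForm∈normalForms : ∀ φ → normalForm φ ∈ normalForms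
  normalForm∈normalForms φ = shannon∈shannonForms (allFin (suc m)) (λ v → eval v φ)

  eval-normalForm : ∀ φ v → eval v (normalForm φ) ≡ eval v φ
  eval-normalForm φ v = trans (eval-shannon (allFin (suc m)) (λ u → eval u φ) v)
    (eval-cong (λ y → restrictTo-agrees (allFin (suc m)) v y (∈-allFin y)) φ)

  ⋀ : List (Formula m) → Formula m
  ⋀ []      = ⊤f
  ⋀ (φ ∷ L) = φ ∧' ⋀ L

  eval-⋀⁻ : ∀ v L φ → eval v (⋀ L) ≡ true → φ ∈ L → eval v φ ≡ true
  eval-⋀⁻ v (ψ ∷ L) φ ⋀L (here refl) = ∧-conicalˡ _ _ ⋀L
  eval-⋀⁻ v (ψ ∷ L) φ ⋀L (there φ∈L) = eval-⋀⁻ v L φ (∧-conicalʳ _ _ ⋀L) φ∈L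

  eval-⋀⁺ : ∀ v L → (∀ φ → φ ∈ L → eval v φ ≡ true) → eval v (⋀ L) ≡ true
  eval-⋀⁺ v []      all = eval-⊤f v
  eval-⋀⁺ v (ψ ∷ L) all rewrite all ψ (here refl) = eval-⋀⁺ v L (λ φ φ∈L → all φ (there φ∈L))

module _ (em : ExcludedMiddle (lsuc 0ℓ)) where

  decide : (P : Set) → Dec P
  decide P = map′ lower lift em

  dne : {P : Set} → ¬ ¬ P → P
  dne {P} = decidable-stable (decide P)

  -- Minimality only yields ¬ (M < M′) for a rival minimal M′, i.e. ¬ ¬ (M′ ≦ M).
  least⇒uniqueMinimal : ∀ {m} {_≦_ : FSet m → FSet m → Set} {S : FSet m → Set} {M : FSet m} →
                        (∀ {X Y} → X ≦ Y → Y ≦ X → X ≐ Y) →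
                        S M → (∀ Y → S Y → M ≦ Y) → IsUniqueMinimal _≦_ S M
  least⇒uniqueMinimal antisym SM least =
      (SM , (λ Y SY Y<M → proj₂ Y<M (least Y SY)))
    , (λ M′ (SM′ , minimal′) →
         antisym (dne (λ M′⋠M → minimal′ _ SM (least M′ SM′ , M′⋠M))) (least M′ SM′))

  module _ {m : ℕ} {Cn : FSet m → FSet m} (isC : IsConsequence Cn) where
    open IsConsequence isC

    Cn-self : ∀ φ → Cn ｛ φ ｝ φ
    Cn-self φ = inclusion ｛ φ ｝ φ refl

    ≐Cn｛｝-self : {X : FSet m} {a : Formula m} → X ≐ Cn ｛ a ｝ → X a
    ≐Cn｛｝-self {a = a} X≐a = proj₂ X≐a a (Cn-self a)

    Cn-cong : {A B : FSet m} → A ≐ B → Cn A ≐ Cn B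
    Cn-cong {A} {B} (A⊆B , B⊆A) = monotony A B A⊆B , monotony B A B⊆A

    Cn｛｝-⊆ : {X : FSet m} {φ : Formula m} → Cn X ⊆ X → X φ → Cn ｛ φ ｝ ⊆ X
    Cn｛｝-⊆ {X} {φ} closed Xφ ψ ψ∈ = closed ψ (monotony ｛ φ ｝ X (λ { _ refl → Xφ }) ψ ψ∈)

    beliefSet-⊨ : {X : FSet m} {φ : Formula m} → BeliefSet Cn X → X ⊨ φ → X φ
    beliefSet-⊨ {X} {φ} bs X⊨φ = proj₂ bs φ (supraclassical X φ X⊨φ)

    Cn｛｝-⊆-⊨ : {φ ψ : Formula m} → ｛ ψ ｝ ⊨ φ → Cn ｛ φ ｝ ⊆ Cn ｛ ψ ｝
    Cn｛｝-⊆-⊨ {φ} {ψ} ψ⊨φ = Cn｛｝-⊆ (iteration ｛ ψ ｝) (supraclassical ｛ ψ ｝ φ ψ⊨φ)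

    Cn⊥-explodes : ∀ φ → Cn ｛ ⊥f ｝ φ
    Cn⊥-explodes φ = supraclassical ｛ ⊥f ｝ φ (⊥f-⊨ refl φ)

    beliefSet⊥-≐-Cn⊥ : {X : FSet m} → BeliefSet Cn X → X ⊥f → X ≐ Cn ｛ ⊥f ｝
    beliefSet⊥-≐-Cn⊥ bs X⊥ = (λ φ _ → Cn⊥-explodes φ) , (λ φ _ → beliefSet-⊨ bs (⊥f-⊨ X⊥ φ))

    Cn-normalForm : ∀ φ → Cn ｛ normalForm φ ｝ ≐ Cn ｛ φ ｝
    Cn-normalForm φ =
        Cn｛｝-⊆-⊨ (λ v true-on → trans (eval-normalForm φ v) (true-on φ refl))
      , Cn｛｝-⊆-⊨ (λ v true-on → trans (sym (eval-normalForm φ v)) (true-on (normalForm φ) refl))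

    beliefSet-finitelyAxiomatised : {X : FSet m} → BeliefSet Cn X → ∃[ a ] (X ≐ Cn ｛ a ｝)
    beliefSet-finitelyAxiomatised {X} bs = ⋀ L , X⊆Cn｛⋀L｝ , Cn｛｝-⊆ (proj₂ bs) X⋀L
      where
      L : List (Formula m)
      L = filter (decide ∘ X) normalForms

      X⋀L : X (⋀ L)
      X⋀L = beliefSet-⊨ bs (λ v true-on-X →
              eval-⋀⁺ v L (λ r r∈L → true-on-X r (proj₂ (∈-filter⁻ (decide ∘ X) {xs = normalForms} r∈L))))

      X⊆Cn｛⋀L｝ : X ⊆ Cn ｛ ⋀ L ｝
      X⊆Cn｛⋀L｝ φ Xφ = supraclassical ｛ ⋀ L ｝ φ (λ v true-on →
        trans (sym (eval-normalForm φ v)) (eval-⋀⁻ v L (normalForm φ) (true-on (⋀ L) refl) nf∈L))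
        where
        nf∈L : normalForm φ ∈ L
        nf∈L = ∈-filter⁺ (decide ∘ X) (normalForm∈normalForms φ)
                 (beliefSet-⊨ bs (λ v true-on-X → trans (eval-normalForm φ v) (true-on-X φ Xφ)))

    beliefSet-normalAxiom : {X : FSet m} → BeliefSet Cn X →
                            ∃[ r ] (r ∈ normalForms × X ≐ Cn ｛ r ｝)
    beliefSet-normalAxiom bs with beliefSet-finitelyAxiomatised bs
    ... | a , X≐Cn｛a｝ = normalForm a , normalForm∈normalForms a
                        , ≐-trans X≐Cn｛a｝ (≐-sym (Cn-normalForm a))

    inconsistent⇒≡⊥ : ∀ {a A} → (∀ φ → φ ∈ a ∷ A → Cn ｛ φ ｝ ⊥f) → SetEquiv Cn (a ∷ A) [ ⊥f ]
    inconsistent⇒≡⊥ {a} inconsistent =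
        (λ φ φ∈ → ⊥f , here refl , Cn⊥-explodes φ , inconsistent φ φ∈)
      , (λ { _ (here refl) → a , here refl , Cn⊥-explodes a , inconsistent a (here refl) })

    ≡⊥⇒inconsistent : ∀ {φ} → SetEquiv Cn [ φ ] [ ⊥f ] → Cn ｛ φ ｝ ⊥f
    ≡⊥⇒inconsistent (φ≡ , _) with φ≡ _ (here refl)
    ... | _ , here refl , (_ , φ⊢⊥) = φ⊢⊥

    module FromPostulates (K : FSet m) (R : ChoiceRevision m)
                          (closure : Closure Cn K R) (success : Success Cn K R)
                          (vacuity : Vacuity Cn K R) (confirmation : Confirmation Cn K R)
                          (reciprocity : Reciprocity Cn K R) (consistency : Consistency Cn K R)
                          where
      private
        K∗ : List (Formula m) → FSet m
        K∗ = rev R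

      Outcome : FSet m → Set
      Outcome X = ∃[ A ] (X ≐ K∗ A)

      _⊑_ : FSet m → FSet m → Set
      X ⊑ Y = ∃[ a ] ∃[ b ] (X ≐ Cn ｛ a ｝ × Y ≐ Cn ｛ b ｝ × K∗ (a ∷ b ∷ []) ≐ X)

      ⊑-resp : ∀ X X′ Y Y′ → X ≐ X′ → Y ≐ Y′ → X ⊑ Y → X′ ⊑ Y′
      ⊑-resp X X′ Y Y′ X≐X′ Y≐Y′ (a , b , X≐a , Y≐b , ab≐X) =
        a , b , ≐-trans (≐-sym X≐X′) X≐a , ≐-trans (≐-sym Y≐Y′) Y≐b , ≐-trans ab≐X X≐X′

      outcome-beliefSet : ∀ {X} → Outcome X → BeliefSet Cn X
      outcome-beliefSet (A , X≐K∗A) = ≐-trans X≐K∗A (≐-trans (≐-sym (closure A)) (Cn-cong (≐-sym X≐K∗A)))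

      outcome-normalAxiom : ∀ {X} → Outcome X → ∃[ r ] (r ∈ normalForms × X ≐ Cn ｛ r ｝)
      outcome-normalAxiom = beliefSet-normalAxiom ∘ outcome-beliefSet

      K-outcome : Outcome K
      K-outcome = [] , ≐-sym (vacuity [] refl)

      ∗-⊇-Cn｛｝ : ∀ A {φ} → K∗ A φ → Cn ｛ φ ｝ ⊆ K∗ A
      ∗-⊇-Cn｛｝ A = Cn｛｝-⊆ (proj₁ (closure A))

      ∗-singleton-success : ∀ φ → K∗ [ φ ] φ
      ∗-singleton-success φ with success [ φ ] (λ ())
      ... | _ , here refl , K∗φ = K∗φ

      ∗-pair-success : ∀ a b → Cn ｛ a ｝ ⊆ K∗ (a ∷ b ∷ []) ⊎ Cn ｛ b ｝ ⊆ K∗ (a ∷ b ∷ [])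
      ∗-pair-success a b with success (a ∷ b ∷ []) (λ ())
      ... | _ , here refl , K∗a         = inj₁ (∗-⊇-Cn｛｝ (a ∷ b ∷ []) K∗a)
      ... | _ , there (here refl) , K∗b = inj₂ (∗-⊇-Cn｛｝ (a ∷ b ∷ []) K∗b)

      ∗-pair-cong : ∀ {a a′ b b′} → Cn ｛ a ｝ ≐ Cn ｛ a′ ｝ → Cn ｛ b ｝ ≐ Cn ｛ b′ ｝ →
                    K∗ (a ∷ b ∷ []) ≐ K∗ (a′ ∷ b′ ∷ [])
      ∗-pair-cong a≐a′ b≐b′ =
        reciprocity _ _ (meets a≐a′ b≐b′) (meets (≐-sym a≐a′) (≐-sym b≐b′))
        where
        meets : ∀ {a a′ b b′} → Cn ｛ a ｝ ≐ Cn ｛ a′ ｝ → Cn ｛ b ｝ ≐ Cn ｛ b′ ｝ →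
                Meets (K∗ (a ∷ b ∷ [])) (a′ ∷ b′ ∷ [])
        meets {a} {a′} {b} {b′} a≐a′ b≐b′ with ∗-pair-success a b
        ... | inj₁ Cn｛a｝⊆ = a′ , here refl , Cn｛a｝⊆ a′ (≐Cn｛｝-self a≐a′)
        ... | inj₂ Cn｛b｝⊆ = b′ , there (here refl) , Cn｛b｝⊆ b′ (≐Cn｛｝-self b≐b′)

      ∗-pair-comm : ∀ a b → K∗ (a ∷ b ∷ []) ≐ K∗ (b ∷ a ∷ [])
      ∗-pair-comm a b = resp R _ _ (λ φ → swap , swap)
        where
        swap : ∀ {φ x y} → φ ∈ x ∷ y ∷ [] → φ ∈ y ∷ x ∷ []
        swap (here φ≡x)         = there (here φ≡x)
        swap (there (here φ≡y)) = here φ≡y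

      ⊑-antisym : ∀ {X Y} → X ⊑ Y → Y ⊑ X → X ≐ Y
      ⊑-antisym (a , b , X≐a , Y≐b , ab≐X) (c , d , Y≐c , X≐d , cd≐Y) =
        ≐-trans (≐-sym ab≐X) (≐-trans (∗-pair-comm a b)
          (≐-trans (∗-pair-cong (≐-trans (≐-sym Y≐b) Y≐c) (≐-trans (≐-sym X≐a) X≐d)) cd≐Y))

      -- With axioms p of K ∗ A and q of Y, reciprocity gives K ∗ {p, q} = K ∗ A.
      ∗-⊑ : ∀ A → A ≢ [] → ∀ {Y} → Outcome Y → Meets Y A → K∗ A ⊑ Y
      ∗-⊑ A A≢[] {Y} outY (y , y∈A , Yy)
        with outcome-normalAxiom (A , ≐-refl) | outcome-normalAxiom outY
      ... | p , _ , K∗A≐p | q , _ , Y≐q =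
        p , q , K∗A≐p , Y≐q , reciprocity (p ∷ q ∷ []) A pq-meets-A (p , here refl , ≐Cn｛｝-self K∗A≐p)
        where
        pq-meets-A : Meets (K∗ (p ∷ q ∷ [])) A
        pq-meets-A with ∗-pair-success p q
        ... | inj₂ Cn｛q｝⊆ = y , y∈A , Cn｛q｝⊆ y (proj₁ Y≐q y Yy)
        ... | inj₁ Cn｛p｝⊆ with success A A≢[]
        ...   | ψ , ψ∈A , K∗Aψ = ψ , ψ∈A , Cn｛p｝⊆ ψ (proj₁ K∗A≐p ψ K∗Aψ)

      K-⊑ : ∀ {X} → Outcome X → K ⊑ X
      K-⊑ outX with outcome-normalAxiom K-outcome | outcome-normalAxiom outX
      ... | k , _ , K≐k | x , _ , X≐x = k , x , K≐k , X≐x , confirmation _ (k , here refl , ≐Cn｛｝-self K≐k)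

      ∗-uniqueMinimal : ∀ A → A ≢ [] → (S : FSet m → Set) → S (K∗ A) →
                        (∀ Y → S Y → Outcome Y × Meets Y A) → IsUniqueMinimal _⊑_ S (K∗ A)
      ∗-uniqueMinimal A A≢[] S SK∗A S⊆ = least⇒uniqueMinimal ⊑-antisym SK∗A
        (λ Y SY → ∗-⊑ A A≢[] (proj₁ (S⊆ Y SY)) (proj₂ (S⊆ Y SY)))

      ∗-singleton : ∀ a → Outcome (Cn ｛ a ｝) → K∗ [ a ] ≐ Cn ｛ a ｝
      ∗-singleton a ([] , a≐K∗[]) =
        ≐-trans (confirmation [ a ] (a , here refl , proj₁ a≐K a (Cn-self a))) (≐-sym a≐K)
        where
        a≐K = ≐-trans a≐K∗[] (vacuity [] refl)
      ∗-singleton a (b ∷ B , a≐K∗B) =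
        ≐-trans (reciprocity [ a ] (b ∷ B) a-meets-B (a , here refl , proj₁ a≐K∗B a (Cn-self a)))
                (≐-sym a≐K∗B)
        where
        a-meets-B : Meets (K∗ [ a ]) (b ∷ B)
        a-meets-B with success (b ∷ B) (λ ())
        ... | ψ , ψ∈B , K∗Bψ =
          ψ , ψ∈B , ∗-⊇-Cn｛｝ [ a ] (∗-singleton-success a) ψ (proj₂ a≐K∗B ψ K∗Bψ)

      module _ (Φ : Descriptor m) where

        SatisfiesΦ : FSet m → Set
        SatisfiesΦ X = Outcome X × Sat X Φ

        satisfiesΦ? : Decidable (SatisfiesΦ ∘ Cn ∘ ｛_｝)
        satisfiesΦ? r = decide (SatisfiesΦ (Cn ｛ r ｝))

        AΦ : List (Formula m)
        AΦ = filter satisfiesΦ? normalForms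

        meets-AΦ : ∀ {Y} → SatisfiesΦ Y → Meets Y AΦ
        meets-AΦ {Y} (outY , satY) with outcome-normalAxiom outY
        ... | y , y∈ , Y≐y =
          y , ∈-filter⁺ satisfiesΦ? y∈ ((_ , ≐-trans (≐-sym Y≐y) (proj₂ outY)) , Sat-resp Y≐y satY)
            , ≐Cn｛｝-self Y≐y

        -- K ∗ A_Φ contains some r ∈ A_Φ, so reciprocity identifies it with K ∗ {r} = Cn{r}.
        ∗AΦ-satisfiesΦ : AΦ ≢ [] → SatisfiesΦ (K∗ AΦ)
        ∗AΦ-satisfiesΦ AΦ≢[] with success AΦ AΦ≢[]
        ... | r , r∈AΦ , K∗AΦr with proj₂ (∈-filter⁻ satisfiesΦ? {xs = normalForms} r∈AΦ)
        ...   | outr , satr = (AΦ , ≐-refl) , Sat-resp r≐K∗AΦ satr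
          where
          K∗r≐r = ∗-singleton r outr
          r≐K∗AΦ : Cn ｛ r ｝ ≐ K∗ AΦ
          r≐K∗AΦ = ≐-trans (≐-sym K∗r≐r)
            (reciprocity [ r ] AΦ (r , r∈AΦ , ≐Cn｛｝-self K∗r≐r) (r , here refl , K∗AΦr))

        descriptor-minimum : ∃[ X ] SatisfiesΦ X → ∃[ M ] IsUniqueMinimal _⊑_ SatisfiesΦ M
        descriptor-minimum (X , satX) = K∗ AΦ , ∗-uniqueMinimal AΦ AΦ≢[] SatisfiesΦ
          (∗AΦ-satisfiesΦ AΦ≢[]) (λ Y satY → proj₁ satY , meets-AΦ satY)
          where
          AΦ≢[] = Meets⇒≢[] (meets-AΦ satX)

      model : RelModel Cn K
      model = record
        { 𝕏        = Outcome
        ; _≦_      = _⊑_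
        ; 𝕏-resp   = λ X Y X≐Y (A , X≐K∗A) → A , ≐-trans (≐-sym X≐Y) X≐K∗A
        ; ≦-resp   = ⊑-resp
        ; 𝕏-belief = λ X → outcome-beliefSet
        ; K∈𝕏      = K-outcome
        ; K-least  = λ X → K-⊑
        ; descr    = descriptor-minimum
        }

      determined : DeterminedBy model R
      determined = minimum , default
        where
        minimum : ∀ A → A ≢ [] → ∃[ X ] 𝕏[_] model A X → IsUniqueMinimal _⊑_ (𝕏[_] model A) (K∗ A)
        minimum A A≢[] _ = ∗-uniqueMinimal A A≢[] _ ((A , ≐-refl) , success A A≢[]) (λ _ → id)

        default : ∀ A → A ≡ [] ⊎ ¬ (∃[ X ] 𝕏[_] model A X) → K∗ A ≐ K
        default []      _            = vacuity [] refl
        default (a ∷ A) (inj₂ empty) =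
          ⊥-elim (empty (K∗ (a ∷ A) , (a ∷ A , ≐-refl) , success (a ∷ A) (λ ())))

      Cn⊥-outcome : Outcome (Cn ｛ ⊥f ｝)
      Cn⊥-outcome =
        [ ⊥f ] , ≐-sym (beliefSet⊥-≐-Cn⊥ (outcome-beliefSet ([ ⊥f ] , ≐-refl)) (∗-singleton-success ⊥f))

      -- M_φ is K ∗ {φ}; it lies strictly below Cn{⊥} since consistency keeps ⊥ out of it.
      extra : Extra model
      extra = Cn⊥-outcome , λ φ φ⊬⊥ →
          K∗ [ φ ]
        , ∗-uniqueMinimal [ φ ] (λ ()) _ ((_ , ≐-refl) , ∗-singleton-success φ)
            (λ Y (outY , Yφ) → outY , φ , here refl , Yφ)
        , K∗φ⊑Cn⊥ φ
        , λ Cn⊥⊑K∗φ → consistency [ φ ] (φ⊬⊥ ∘ ≡⊥⇒inconsistent)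
            (proj₁ (⊑-antisym Cn⊥⊑K∗φ (K∗φ⊑Cn⊥ φ)) ⊥f (Cn⊥-explodes ⊥f))
        where
        K∗φ⊑Cn⊥ : ∀ φ → K∗ [ φ ] ⊑ Cn ｛ ⊥f ｝
        K∗φ⊑Cn⊥ φ = ∗-⊑ [ φ ] (λ ()) Cn⊥-outcome (φ , here refl , Cn⊥-explodes φ)

    module ToPostulates (K : FSet m) (consistentK : ConsistentBeliefSet Cn K) (R : ChoiceRevision m)
                        (𝓜 : RelModel Cn K) (determined : DeterminedBy 𝓜 R) (extra : Extra 𝓜)
                        where
      private
        K∗ : List (Formula m) → FSet m
        K∗ = rev R

        Cn⊥∈𝕏 : 𝕏 𝓜 (Cn ｛ ⊥f ｝)
        Cn⊥∈𝕏 = proj₁ extra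

      vacuity : Vacuity Cn K R
      vacuity A A≡[] = proj₂ determined A (inj₁ A≡[])

      ∗-minimum : ∀ A → A ≢ [] → IsUniqueMinimal (_≦_ 𝓜) (𝕏[_] 𝓜 A) (K∗ A)
      ∗-minimum []      A≢[] = ⊥-elim (A≢[] refl)
      ∗-minimum (a ∷ A) A≢[] =
        proj₁ determined (a ∷ A) A≢[] (Cn ｛ ⊥f ｝ , Cn⊥∈𝕏 , a , here refl , Cn⊥-explodes a)

      ∗-∈𝕏[] : ∀ A → A ≢ [] → 𝕏[_] 𝓜 A (K∗ A)
      ∗-∈𝕏[] A A≢[] = proj₁ (proj₁ (∗-minimum A A≢[]))

      ∗-beliefSet : ∀ A → BeliefSet Cn (K∗ A)
      ∗-beliefSet []      = ≐-trans K∗[]≐K (≐-trans (proj₁ consistentK) (Cn-cong (≐-sym K∗[]≐K)))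
        where
        K∗[]≐K = vacuity [] refl
      ∗-beliefSet (a ∷ A) = 𝕏-belief 𝓜 _ (proj₁ (∗-∈𝕏[] (a ∷ A) (λ ())))

      ∗-++-comm : ∀ A B → K∗ (A ++ B) ≐ K∗ (B ++ A)
      ∗-++-comm A B = resp R (A ++ B) (B ++ A) (λ φ → swap A B , swap B A)
        where
        swap : ∀ A B {φ} → φ ∈ A ++ B → φ ∈ B ++ A
        swap A B φ∈ with ∈-++⁻ A φ∈
        ... | inj₁ φ∈A = ∈-++⁺ʳ B φ∈A
        ... | inj₂ φ∈B = ∈-++⁺ˡ φ∈B

      -- 𝕏_A ⊆ 𝕏_{A∪B}, so the minimum of 𝕏_{A∪B}, once in 𝕏_A, is minimal there.
      ∗-++-left : ∀ A B → Meets (K∗ (A ++ B)) A → K∗ A ≐ K∗ (A ++ B)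
      ∗-++-left A B meetsA = ≐-sym (proj₂ (∗-minimum A (Meets⇒≢[] meetsA)) _
        (minimal-restrict {_≦_ = _≦_ 𝓜} widen (proj₁ (∗-minimum (A ++ B) A++B≢[]))
          (proj₁ (∗-∈𝕏[] (A ++ B) A++B≢[]) , meetsA)))
        where
        A++B≢[] : A ++ B ≢ []
        A++B≢[] = ∈⇒≢[] (∈-++⁺ˡ (proj₁ (proj₂ meetsA)))
        widen : ∀ X → 𝕏[_] 𝓜 A X → 𝕏[_] 𝓜 (A ++ B) X
        widen X (X∈𝕏 , φ , φ∈A , Xφ) = X∈𝕏 , φ , ∈-++⁺ˡ φ∈A , Xφ

      ∗-++-both : ∀ A B → Meets (K∗ (A ++ B)) A → Meets (K∗ A) B →
                  K∗ A ≐ K∗ (A ++ B) × K∗ B ≐ K∗ (A ++ B)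
      ∗-++-both A B meetsA A-meets-B = eA , ≐-trans eB (≐-sym (∗-++-comm A B))
        where
        eA = ∗-++-left A B meetsA
        eB = ∗-++-left B A (Meets-resp (≐-trans eA (∗-++-comm A B)) A-meets-B)

      closure : Closure Cn K R
      closure A = ≐-sym (∗-beliefSet A)

      success : Success Cn K R
      success A A≢[] = proj₂ (∗-∈𝕏[] A A≢[])

      confirmation : Confirmation Cn K R
      confirmation A (φ , φ∈A , Kφ) = ≐-sym (proj₂ (∗-minimum A (∈⇒≢[] φ∈A)) K
        ((K∈𝕏 𝓜 , φ , φ∈A , Kφ) , (λ Y (Y∈𝕏 , _) Y<K → proj₂ Y<K (K-least 𝓜 Y Y∈𝕏))))

      reciprocity : Reciprocity Cn K R
      reciprocity A B A-meets-B B-meets-A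
        with Meets-++⁻ A (success (A ++ B) (∈⇒≢[] (∈-++⁺ˡ (proj₁ (proj₂ B-meets-A)))))
      ... | inj₁ meetsA = let (eA , eB) = ∗-++-both A B meetsA A-meets-B in ≐-trans eA (≐-sym eB)
      ... | inj₂ meetsB = let (eB , eA) = ∗-++-both B A (Meets-resp (∗-++-comm A B) meetsB) B-meets-A
                          in ≐-trans eA (≐-sym eB)

      -- If every φ ∈ A were inconsistent, A ≡ {⊥}; a consistent φ ∈ A has a minimum M_φ ∈ 𝕏_A
      -- strictly below Cn{⊥}, which K ∗ A would equal if it contained ⊥.
      consistency : Consistency Cn K R
      consistency []      _      K∗[]⊥ = proj₂ consistentK (proj₁ (vacuity [] refl) ⊥f K∗[]⊥)
      consistency (a ∷ A) A≢｛⊥｝ K∗A⊥ with consistent-member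
        where
        consistent-member : ∃[ φ ] (φ ∈ a ∷ A × ¬ Cn ｛ φ ｝ ⊥f)
        consistent-member = dne λ none →
          A≢｛⊥｝ (inconsistent⇒≡⊥ (λ φ φ∈ → dne (λ φ⊬⊥ → none (φ , φ∈ , φ⊬⊥))))
      ... | φ , φ∈A , φ⊬⊥ with proj₂ extra φ φ⊬⊥
      ...   | Mφ , (((Mφ∈𝕏 , Mφφ) , _) , _) , (Mφ≦Cn⊥ , Cn⊥⋠Mφ) =
        proj₂ (proj₁ (∗-minimum (a ∷ A) (λ ()))) Mφ (Mφ∈𝕏 , φ , φ∈A , Mφφ)
          ( ≦-resp 𝓜 _ _ _ _ ≐-refl (≐-sym K∗A≐Cn⊥) Mφ≦Cn⊥
          , Cn⊥⋠Mφ ∘ ≦-resp 𝓜 _ _ _ _ K∗A≐Cn⊥ ≐-refl )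
        where
        K∗A≐Cn⊥ = beliefSet⊥-≐-Cn⊥ (∗-beliefSet (a ∷ A)) K∗A⊥

      postulates : Postulates Cn K R
      postulates = closure , success , vacuity , confirmation , reciprocity , consistency

theorem2 : ExcludedMiddle (lsuc 0ℓ) →
    (m : ℕ) (Cn : FSet m → FSet m) → IsConsequence Cn →
    (K : FSet m) → ConsistentBeliefSet Cn K →
    (R : ChoiceRevision m) →
    (Postulates Cn K R →
       Σ (RelModel Cn K) (λ 𝓜 → DeterminedBy 𝓜 R × Extra 𝓜))
    × (Σ (RelModel Cn K) (λ 𝓜 → DeterminedBy 𝓜 R × Extra 𝓜) →
       Postulates Cn K R)
theorem2 em m Cn isC K consistentK R = completeness , soundness
  where
  completeness : Postulates Cn K R → Σ (RelModel Cn K) (λ 𝓜 → DeterminedBy 𝓜 R × Extra 𝓜)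
  completeness (closure , success , vacuity , confirmation , reciprocity , consistency) =
    model , determined , extra
    where
    open FromPostulates em isC K R closure success vacuity confirmation reciprocity consistency

  soundness : Σ (RelModel Cn K) (λ 𝓜 → DeterminedBy 𝓜 R × Extra 𝓜) → Postulates Cn K R
  soundness (𝓜 , determined , extra) = ToPostulates.postulates em isC K consistentK R 𝓜 determined extra
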